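{- Let $X=(V,E)$ be a digraph and $e\in E$ an edge. Then the Redei-Berge polynomials satisfy the deletion-contraction relation \[u_X(m)=u_{X\setminus e}(m)-u_{X/e}(m).\]
   Context: A digraph is a pair $X=(V,E)$ with $V$ finite and $E\subset\{(u,v)\in V\times V\mid u\ne v\}$; $n=|V|$. A $V$-listing is a bijection $\sigma:[n]\to V$; $\Sigma_V$ is the set of $V$-listings; $X\mathrm{Des}(\sigma)=\{1\le i\le n-1\mid(\sigma_i,\sigma_{i+1})\in E\}$. For $I\subset[n-1]$, $F_I=\sum x_{i_1}\cdots x_{i_n}$ over $1\le i_1\le\cdots\le i_n$ with $i_j<i_{j+1}$ for $j\in I$. The Redei-Berge symmetric function is $U_X=\sum_{\sigma\in\Sigma_V}F_{X\mathrm{Des}(\sigma)}$ and the Redei-Berge polynomial is $u_X(m)=U_X(1,\dots,1,0,0,\dots)$ with $m$ ones (a polynomial in $m$). The deletion is $X\setminus e=(V,E\setminus\{e\})$. For $e=(u,v)\in E$, the contraction $X/e=(V',E')$ has vertex set $V'=(V\setminus\{u,v\})\cup\{e\}$ (with $e$ a new vertex), and $E'$ consists of all edges of $E$ with both endpoints different from $u,v$, together with, for each $w\in V\setminus\{u,v\}$: $(w,e)\in E'$ iff $(w,u)\in E$, and $(e,w)\in E'$ iff $(v,w)\in E$. -}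

module Defs where

open import Data.Nat using (ℕ; zero; suc; _≤ᵇ_; _<ᵇ_)
open import Data.Bool using (Bool; true; false; _∧_; _∨_; not; if_then_else_)
open import Data.Fin using (Fin; toℕ; inject₁; punchIn; punchOut; _≟_)
open import Data.Fin.Subset using (Subset)
open import Data.List using (List; []; _∷_; map; concatMap; allFin; filterᵇ; length)
open import Data.Nat.ListAction using (sum)
open import Data.Vec using (Vec; []; _∷_; lookup; tabulate)
open import Data.Empty using (⊥)
open import Relation.Nullary.Decidable using (⌊_⌋)
open import Relation.Binary.PropositionalEquality using (_≡_; _≢_; refl; sym; trans; cong)

record Digraph (n : ℕ) : Set where
  field
    edge     : Fin n → Fin n → Bool
    loopless : ∀ v → edge v v ≡ false
open Digraph public

allᵇ : {A : Set} → (A → Bool) → List A → Bool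
allᵇ p []       = true
allᵇ p (x ∷ xs) = p x ∧ allᵇ p xs

allVecs : {A : Set} → List A → (k : ℕ) → List (Vec A k)
allVecs xs zero    = [] ∷ []
allVecs xs (suc k) = concatMap (λ x → map (x ∷_) (allVecs xs k)) xs

-- σ : Vec (Fin n) n is a V-listing iff i ↦ σ_i is a bijection [n] → V,
-- i.e. (for a self-map of a finite set) injective.
isListing : {n : ℕ} → Vec (Fin n) n → Bool
isListing {n} σ =
  allᵇ (λ i → allᵇ (λ j → ⌊ i ≟ j ⌋ ∨ not ⌊ lookup σ i ≟ lookup σ j ⌋) (allFin n)) (allFin n)

listings : (n : ℕ) → List (Vec (Fin n) n)
listings n = filterᵇ isListing (allVecs (allFin n) n)

-- X Des(σ) ⊆ [n-1] for n = suc n'.  Position i : Fin n' (0-based) stands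
-- for the paper's index i+1, comparing σ_{i+1} and σ_{i+2}.
XDes : {n' : ℕ} → Digraph (suc n') → Vec (Fin (suc n')) (suc n') → Subset n'
XDes X σ = tabulate (λ i → edge X (lookup σ (inject₁ i)) (lookup σ (Data.Fin.suc i)))

-- F_I(1,…,1,0,0,…) with m ones, for I ⊆ [n'] and n = n'+1 variables-indices:
-- the number of sequences 1 ≤ i_1 ≤ … ≤ i_n ≤ m with i_j < i_{j+1} for j ∈ I.
-- (Values i_j are represented 0-based as elements of Fin m.)
compatible : {m n' : ℕ} → Subset n' → Vec (Fin m) (suc n') → Bool
compatible {m} {n'} I a =
  allᵇ (λ i → let x = toℕ (lookup a (inject₁ i)) ; y = toℕ (lookup a (Data.Fin.suc i))
              in if lookup I i then x <ᵇ y else x ≤ᵇ y) (allFin n')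

Fone : (m : ℕ) {n' : ℕ} → Subset n' → ℕ
Fone m {n'} I = length (filterᵇ (compatible I) (allVecs (allFin m) (suc n')))

-- Redei-Berge polynomial u_X(m) = U_X(1^m) = Σ_σ F_{XDes(σ)}(1^m).
-- (For n = 0 the unique empty listing contributes F_∅ = 1.)
u : {n : ℕ} → Digraph n → ℕ → ℕ
u {zero}   X m = 1
u {suc n'} X m = sum (map (λ σ → Fone m (XDes X σ)) (listings (suc n')))

delete : {n : ℕ} → Digraph n → Fin n → Fin n → Digraph n
delete X a b = record
  { edge = λ x y → edge X x y ∧ not (⌊ x ≟ a ⌋ ∧ ⌊ y ≟ b ⌋)
  ; loopless = λ x → cong (λ t → t ∧ not (⌊ x ≟ a ⌋ ∧ ⌊ x ≟ b ⌋)) (loopless X x) }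

edge⇒≢ : {n : ℕ} (X : Digraph n) {a b : Fin n} → edge X a b ≡ true → a ≢ b
edge⇒≢ X {a} ab refl with trans (sym (loopless X a)) ab
... | ()

-- Vertex set V' = (V ∖ {a,b}) ∪ {e} is represented by Fin (suc k):
-- zero is the new vertex e, and suc j is the j-th vertex of V ∖ {a,b}
-- (in increasing order), namely  rest j = punchIn a (punchIn b' j)
-- where b' = punchOut (a ≢ b) is b with a removed.
module _ {k : ℕ} (X : Digraph (suc (suc k))) (a b : Fin (suc (suc k)))
         (ab : edge X a b ≡ true) where
  rest : Fin k → Fin (suc (suc k))
  rest j = punchIn a (punchIn (punchOut (edge⇒≢ X ab)) j)

  contractEdge : Fin (suc k) → Fin (suc k) → Bool
  contractEdge Data.Fin.zero     Data.Fin.zero     = false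
  contractEdge Data.Fin.zero     (Data.Fin.suc j)  = edge X b (rest j)
  contractEdge (Data.Fin.suc i)  Data.Fin.zero     = edge X (rest i) a
  contractEdge (Data.Fin.suc i)  (Data.Fin.suc j)  = edge X (rest i) (rest j)

  contractLoopless : ∀ v → contractEdge v v ≡ false
  contractLoopless Data.Fin.zero    = refl
  contractLoopless (Data.Fin.suc i) = loopless X (rest i)

  contract : Digraph (suc k)
  contract = record { edge = contractEdge ; loopless = contractLoopless }

{-# OPTIONS --safe #-}
module Submission where

-- Fix a listing σ of X. Deleting e = (a, b) changes XDes(σ) only when b immediately follows a in σ,
-- say at position i, and then it removes i. Splitting the weak inequality at i into "<" and "="
-- gives F_{I∖{i}}(1^m) = F_I(1^m) + F_{I′}(1^m), where I′ is I with position i merged away, and I′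
-- is exactly the descent set in X/e of the listing obtained from σ by replacing the consecutive
-- pair a b by e. Every listing of X/e arises in this way from exactly one listing of X, hence
-- u_{X∖e} = u_X + u_{X/e}.

open import Defs
open import Data.Nat using (ℕ; zero; suc; _+_; _≤ᵇ_; _<ᵇ_; _≡ᵇ_)
open import Data.Nat.Properties using (+-identityʳ; +-commutativeSemigroup; <-irrefl; m≤n+m; m+n∸n≡m)
open import Data.Nat.ListAction using (sum)
open import Data.Nat.ListAction.Properties using (sum-++; sum-↭)
open import Algebra.Properties.CommutativeSemigroup +-commutativeSemigroup using (interchange)
open import Data.Integer using (+_; _-_)
open import Data.Integer.Properties using ([+m]-[+n]≡m⊖n; ⊖-≥)
open import Data.Bool using (Bool; true; false; T; _∧_; _∨_; not; if_then_else_)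
open import Data.Bool.Properties using (T-∧; ∧-identityʳ; ∧-zeroʳ)
open import Data.Unit using (tt)
open import Data.Fin as Fin using (Fin; toℕ; inject₁; punchIn; punchOut; _≟_)
open import Data.Fin.Properties using (any?; injective⇒≤; inject₁-injective; suc-injective; punchIn-injective; punchInᵢ≢i; punchIn-punchOut; punchOut-punchIn; punchOut-injective)
open import Data.Fin.Subset using (Subset)
open import Data.List as List using (List; []; _∷_; map; concatMap; allFin; filterᵇ; length; mapMaybe; cartesianProductWith)
open import Data.List.Properties using (map-++; map-∘; map-cong; map-cong-local; map-tabulate)
open import Data.List.Membership.Propositional using (_∈_)
open import Data.List.Membership.Propositional.Properties using (∈-allFin; ∈-filter⁺; ∈-filter⁻; ∈-cartesianProductWith⁺)
open import Data.List.Membership.Propositional.Properties.WithK using (unique∧set⇒bag)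
open import Data.List.Relation.Binary.BagAndSetEquality using (∼bag⇒↭)
open import Data.List.Relation.Binary.Permutation.Propositional.Properties using (map⁺)
import Data.List.Relation.Unary.All as All
open import Data.List.Relation.Unary.AllPairs using ([]; _∷_)
open import Data.List.Relation.Unary.Any using (here; there)
open import Data.List.Relation.Unary.Unique.Propositional using (Unique)
import Data.List.Relation.Unary.Unique.Propositional.Properties as Unique
open import Data.Maybe as Maybe using (Maybe; just; nothing; maybe)
open import Data.Product using (∃; _×_; _,_; proj₁; proj₂)
open import Data.Sum using (_⊎_; inj₁; inj₂)
open import Data.Vec as Vec using (Vec; []; _∷_; lookup; tabulate; insertAt; removeAt; _[_]≔_)
import Data.Vec.Properties as Vecₚ
open import Data.Vec.Properties
  using (∷-injective; tabulate-cong; tabulate∘lookup; lookup∘tabulate; lookup∘update; lookup∘update′;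
         insertAt-lookup; insertAt-punchIn; removeAt-punchOut; removeAt-insertAt; insertAt-removeAt; lookup-map; map-id)
open import Function using (_∘_; id; _⇔_; Equivalence; mk⇔)
open import Function.Definitions using (Injective)
open import Relation.Nullary using (¬_; Dec; yes; no; contradiction)
open import Relation.Nullary.Decidable using (⌊_⌋; T?; _×-dec_)
open import Relation.Binary.PropositionalEquality using (_≡_; _≢_; refl; sym; trans; cong; cong₂; subst; module ≡-Reasoning)

module _ {A : Set} where

  sum-map-+ : (f g : A → ℕ) (xs : List A) →
              sum (map (λ x → f x + g x) xs) ≡ sum (map f xs) + sum (map g xs)
  sum-map-+ f g []       = refl
  sum-map-+ f g (x ∷ xs) = trans (cong (_+_ (f x + g x)) (sum-map-+ f g xs)) (interchange (f x) (g x) _ _)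

  sum-map-zero : (xs : List A) → sum (map (λ _ → 0) xs) ≡ 0
  sum-map-zero []       = refl
  sum-map-zero (x ∷ xs) = sum-map-zero xs

  length-filterᵇ : (p : A → Bool) (xs : List A) →
                   length (filterᵇ p xs) ≡ sum (map (λ x → if p x then 1 else 0) xs)
  length-filterᵇ p []       = refl
  length-filterᵇ p (x ∷ xs) with p x
  ... | true  = cong suc (length-filterᵇ p xs)
  ... | false = length-filterᵇ p xs

sum-map-concatMap : {A B : Set} (f : B → ℕ) (g : A → List B) (xs : List A) →
                    sum (map f (concatMap g xs)) ≡ sum (map (λ x → sum (map f (g x))) xs)
sum-map-concatMap f g []       = refl
sum-map-concatMap f g (x ∷ xs) = begin
  sum (map f (g x List.++ concatMap g xs))               ≡⟨ cong sum (map-++ f (g x) _) ⟩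
  sum (map f (g x) List.++ map f (concatMap g xs))       ≡⟨ sum-++ (map f (g x)) _ ⟩
  sum (map f (g x)) + sum (map f (concatMap g xs))       ≡⟨ cong (_+_ (sum (map f (g x)))) (sum-map-concatMap f g xs) ⟩
  sum (map f (g x)) + sum (map (λ x → sum (map f (g x))) xs) ∎
  where open ≡-Reasoning

module _ {A B : Set} (g : A → Maybe B) where

  sum-map-mapMaybe : (f : B → ℕ) (xs : List A) →
                     sum (map f (mapMaybe g xs)) ≡ sum (map (maybe f 0 ∘ g) xs)
  sum-map-mapMaybe f []       = refl
  sum-map-mapMaybe f (x ∷ xs) with g x
  ... | just y  = cong (_+_ (f y)) (sum-map-mapMaybe f xs)
  ... | nothing = sum-map-mapMaybe f xs

  ∈-mapMaybe⁺ : {xs : List A} {x : A} {y : B} → x ∈ xs → g x ≡ just y → y ∈ mapMaybe g xs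
  ∈-mapMaybe⁺ {x ∷ xs} (here refl) gx≡y with g x
  ∈-mapMaybe⁺ {x ∷ xs} (here refl) refl | just y = here refl
  ∈-mapMaybe⁺ {x ∷ xs} (there x′∈) gx′≡y with g x
  ... | just _  = there (∈-mapMaybe⁺ x′∈ gx′≡y)
  ... | nothing = ∈-mapMaybe⁺ x′∈ gx′≡y

  ∈-mapMaybe⁻ : (xs : List A) {y : B} → y ∈ mapMaybe g xs → ∃ λ x → x ∈ xs × g x ≡ just y
  ∈-mapMaybe⁻ (x ∷ xs) y∈ with g x in gx
  ∈-mapMaybe⁻ (x ∷ xs) (here refl) | just _ = x , here refl , gx
  ∈-mapMaybe⁻ (x ∷ xs) (there y∈)  | just _ with ∈-mapMaybe⁻ xs y∈
  ... | x′ , x′∈ , gx′ = x′ , there x′∈ , gx′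
  ∈-mapMaybe⁻ (x ∷ xs) y∈ | nothing with ∈-mapMaybe⁻ xs y∈
  ... | x′ , x′∈ , gx′ = x′ , there x′∈ , gx′

  InjectiveOn : List A → Set
  InjectiveOn xs = ∀ {x x′ y} → x ∈ xs → x′ ∈ xs → g x ≡ just y → g x′ ≡ just y → x ≡ x′

  mapMaybe-unique : {xs : List A} → InjectiveOn xs → Unique xs → Unique (mapMaybe g xs)
  mapMaybe-unique {[]}     inj []            = []
  mapMaybe-unique {x ∷ xs} inj (x∉ ∷ unique) with g x in gx
  ... | nothing = mapMaybe-unique (λ p q → inj (there p) (there q)) unique
  ... | just y  = All.tabulate y∉ ∷ mapMaybe-unique (λ p q → inj (there p) (there q)) unique
    where
    y∉ : ∀ {z} → z ∈ mapMaybe g xs → y ≢ z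
    y∉ z∈ refl with ∈-mapMaybe⁻ xs z∈
    ... | x′ , x′∈ , gx′ = All.lookup x∉ x′∈ (inj (here refl) (there x′∈) gx gx′)

  sum-reindex-mapMaybe : (f : B → ℕ) {xs : List A} {ys : List B} → Unique xs → Unique ys → InjectiveOn xs →
    (∀ {x y} → x ∈ xs → g x ≡ just y → y ∈ ys) → (∀ {y} → y ∈ ys → ∃ λ x → x ∈ xs × g x ≡ just y) →
    sum (map (maybe f 0 ∘ g) xs) ≡ sum (map f ys)
  sum-reindex-mapMaybe f {xs} {ys} xs-unique ys-unique inj into onto =
    trans (sym (sum-map-mapMaybe f xs)) (sum-↭ (map⁺ f (∼bag⇒↭ (unique∧set⇒bag
      (mapMaybe-unique inj xs-unique) ys-unique (mk⇔ from-mapMaybe to-mapMaybe)))))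
    where
    from-mapMaybe : ∀ {y} → y ∈ mapMaybe g xs → y ∈ ys
    from-mapMaybe y∈ with ∈-mapMaybe⁻ xs y∈
    ... | x , x∈ , gx = into x∈ gx
    to-mapMaybe : ∀ {y} → y ∈ ys → y ∈ mapMaybe g xs
    to-mapMaybe y∈ with onto y∈
    ... | x , x∈ , gx = ∈-mapMaybe⁺ x∈ gx

allᵇ-tabulate : {A : Set} {n : ℕ} (p : A → Bool) (f : Fin n → A) →
                allᵇ p (List.tabulate f) ≡ allᵇ (p ∘ f) (allFin n)
allᵇ-tabulate {n = zero}  p f = refl
allᵇ-tabulate {n = suc n} p f =
  cong (p (f Fin.zero) ∧_) (trans (allᵇ-tabulate p (f ∘ Fin.suc)) (sym (allᵇ-tabulate (p ∘ f) Fin.suc)))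

module _ {A : Set} where

  allᵇ⁻ : (p : A → Bool) {xs : List A} → T (allᵇ p xs) → ∀ {x} → x ∈ xs → T (p x)
  allᵇ⁻ p {y ∷ ys} t (here refl) = proj₁ (Equivalence.to T-∧ t)
  allᵇ⁻ p {y ∷ ys} t (there x∈) = allᵇ⁻ p (proj₂ (Equivalence.to T-∧ t)) x∈

  allᵇ⁺ : (p : A → Bool) (xs : List A) → (∀ {x} → x ∈ xs → T (p x)) → T (allᵇ p xs)
  allᵇ⁺ p []       h = tt
  allᵇ⁺ p (y ∷ ys) h = Equivalence.from T-∧ (h (here refl) , allᵇ⁺ p ys (h ∘ there))

  concatMap-map-∷ : {n : ℕ} (ys : List A) (vs : List (Vec A n)) →
                    concatMap (λ y → map (y Vec.∷_) vs) ys ≡ cartesianProductWith Vec._∷_ ys vs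
  concatMap-map-∷ []       vs = refl
  concatMap-map-∷ (y ∷ ys) vs = cong (map (y Vec.∷_) vs List.++_) (concatMap-map-∷ ys vs)

  ∈-allVecs : {xs : List A} → (∀ x → x ∈ xs) → (n : ℕ) (v : Vec A n) → v ∈ allVecs xs n
  ∈-allVecs every zero    Vec.[]       = here refl
  ∈-allVecs {xs} every (suc n) (x Vec.∷ v) rewrite concatMap-map-∷ xs (allVecs xs n) =
    ∈-cartesianProductWith⁺ Vec._∷_ (every x) (∈-allVecs every n v)

  allVecs-unique : {xs : List A} → Unique xs → (n : ℕ) → Unique (allVecs xs n)
  allVecs-unique u zero    = All.[] ∷ []
  allVecs-unique {xs} u (suc n) rewrite concatMap-map-∷ xs (allVecs xs n) =
    Unique.cartesianProductWith⁺ Vec._∷_ ∷-injective u (allVecs-unique u n)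

sum-map-allVecs-suc : {A : Set} (xs : List A) (n : ℕ) (f : Vec A (suc n) → ℕ) →
  sum (map f (allVecs xs (suc n))) ≡ sum (map (λ x → sum (map (λ v → f (x ∷ v)) (allVecs xs n))) xs)
sum-map-allVecs-suc xs n f =
  trans (sum-map-concatMap f (λ x → map (x ∷_) (allVecs xs n)) xs)
        (cong sum (map-cong (λ x → cong sum (sym (map-∘ (allVecs xs n)))) xs))

sum-allFin-suc : {n : ℕ} (f : Fin (suc n) → ℕ) →
                 sum (map f (allFin (suc n))) ≡ f Fin.zero + sum (map (f ∘ Fin.suc) (allFin n))
sum-allFin-suc {n} f = cong (_+_ (f Fin.zero)) (cong sum (trans (map-tabulate Fin.suc f) (sym (map-tabulate id (f ∘ Fin.suc)))))

-- Phrased with _≡ᵇ_ on toℕ rather than _≟_ so that it reduces under Fin.suc.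
sum-allFin-δ : {n : ℕ} (x : Fin n) (f : Fin n → ℕ) →
               sum (map (λ y → if toℕ x ≡ᵇ toℕ y then f y else 0) (allFin n)) ≡ f x
sum-allFin-δ {suc n} Fin.zero f = begin
  sum (map (λ y → if 0 ≡ᵇ toℕ y then f y else 0) (allFin (suc n))) ≡⟨ sum-allFin-suc (λ y → if 0 ≡ᵇ toℕ y then f y else 0) ⟩
  f Fin.zero + sum (map (λ _ → 0) (allFin n))                     ≡⟨ cong (_+_ (f Fin.zero)) (sum-map-zero (allFin n)) ⟩
  f Fin.zero + 0                                                  ≡⟨ +-identityʳ _ ⟩
  f Fin.zero                                                      ∎
  where open ≡-Reasoning
sum-allFin-δ (Fin.suc x) f =
  trans (sum-allFin-suc (λ y → if toℕ (Fin.suc x) ≡ᵇ toℕ y then f y else 0)) (sum-allFin-δ x (f ∘ Fin.suc))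

-- Counting compatible sequences

ascent : {m : ℕ} → Bool → Fin m → Fin m → Bool
ascent strict x y = if strict then toℕ x <ᵇ toℕ y else toℕ x ≤ᵇ toℕ y

compatible-∷ : {m n : ℕ} (s : Bool) (I : Subset n) (x y : Fin m) (v : Vec (Fin m) n) →
               compatible (s ∷ I) (x ∷ y ∷ v) ≡ ascent s x y ∧ compatible I (y ∷ v)
compatible-∷ {n = n} s I x y v = cong (ascent s x y ∧_) (allᵇ-tabulate {n = n} _ Fin.suc)

chainsFrom : {m n : ℕ} → Subset n → Fin m → ℕ
chainsFrom         []      x = 1
chainsFrom {m = m} (s ∷ I) x = sum (map (λ y → if ascent s x y then chainsFrom I y else 0) (allFin m))

count-compatible≡chainsFrom : {m n : ℕ} (I : Subset n) (x : Fin m) →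
  sum (map (λ w → if compatible I (x ∷ w) then 1 else 0) (allVecs (allFin m) n)) ≡ chainsFrom I x
count-compatible≡chainsFrom         []      x = refl
count-compatible≡chainsFrom {m} {suc n} (s ∷ I) x =
  trans (sum-map-allVecs-suc (allFin m) n (λ w → if compatible (s ∷ I) (x ∷ w) then 1 else 0))
        (cong sum (map-cong count-after (allFin m)))
  where
  tails : List (Vec (Fin m) n)
  tails = allVecs (allFin m) n

  count-guarded : (c : Bool) (y : Fin m) →
    sum (map (λ v → if c ∧ compatible I (y ∷ v) then 1 else 0) tails) ≡ (if c then chainsFrom I y else 0)
  count-guarded true  y = count-compatible≡chainsFrom I y
  count-guarded false y = sum-map-zero tails

  count-after : (y : Fin m) →
    sum (map (λ v → if compatible (s ∷ I) (x ∷ y ∷ v) then 1 else 0) tails) ≡ (if ascent s x y then chainsFrom I y else 0)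
  count-after y =
    trans (cong sum (map-cong (λ v → cong (λ c → if c then 1 else 0) (compatible-∷ s I x y v)) tails))
          (count-guarded (ascent s x y) y)

Fone≡sum-chainsFrom : (m : ℕ) {n : ℕ} (I : Subset n) → Fone m I ≡ sum (map (chainsFrom I) (allFin m))
Fone≡sum-chainsFrom m {n} I = begin
  Fone m I
    ≡⟨ length-filterᵇ (compatible I) (allVecs (allFin m) (suc n)) ⟩
  sum (map (λ v → if compatible I v then 1 else 0) (allVecs (allFin m) (suc n)))
    ≡⟨ sum-map-allVecs-suc (allFin m) n (λ v → if compatible I v then 1 else 0) ⟩
  sum (map (λ x → sum (map (λ w → if compatible I (x ∷ w) then 1 else 0) (allVecs (allFin m) n))) (allFin m))
    ≡⟨ cong sum (map-cong (count-compatible≡chainsFrom I) (allFin m)) ⟩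
  sum (map (chainsFrom I) (allFin m)) ∎
  where open ≡-Reasoning

if-≤ᵇ-split : (p q c : ℕ) →
  (if p ≤ᵇ q then c else 0) ≡ (if p <ᵇ q then c else 0) + (if p ≡ᵇ q then c else 0)
if-≤ᵇ-split zero          zero    c = refl
if-≤ᵇ-split zero          (suc q) c = sym (+-identityʳ c)
if-≤ᵇ-split (suc p)       zero    c = refl
if-≤ᵇ-split (suc zero)    (suc q) c = if-≤ᵇ-split zero q c
if-≤ᵇ-split (suc (suc p)) (suc q) c = if-≤ᵇ-split (suc p) q c

if-+ : (b : Bool) (p q : ℕ) → (if b then p + q else 0) ≡ (if b then p else 0) + (if b then q else 0)
if-+ true  p q = refl
if-+ false p q = refl

chainsFrom-split : {m n : ℕ} (I : Subset (suc n)) (i : Fin (suc n)) → lookup I i ≡ true → (x : Fin m) →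
  chainsFrom (I [ i ]≔ false) x ≡ chainsFrom I x + chainsFrom (removeAt I i) x
chainsFrom-split {m} (true ∷ I) Fin.zero refl x = begin
  sum (map (λ y → if ascent false x y then chainsFrom I y else 0) (allFin m))
    ≡⟨ cong sum (map-cong (λ y → if-≤ᵇ-split (toℕ x) (toℕ y) (chainsFrom I y)) (allFin m)) ⟩
  sum (map (λ y → (if ascent true x y then chainsFrom I y else 0) + (if toℕ x ≡ᵇ toℕ y then chainsFrom I y else 0)) (allFin m))
    ≡⟨ sum-map-+ _ _ (allFin m) ⟩
  chainsFrom (true ∷ I) x + sum (map (λ y → if toℕ x ≡ᵇ toℕ y then chainsFrom I y else 0) (allFin m))
    ≡⟨ cong (_+_ (chainsFrom (true ∷ I) x)) (sum-allFin-δ x (chainsFrom I)) ⟩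
  chainsFrom (true ∷ I) x + chainsFrom I x ∎
  where open ≡-Reasoning
chainsFrom-split {m} (s ∷ t ∷ I) (Fin.suc i) Iᵢ x =
  trans (cong sum (map-cong split-after (allFin m))) (sum-map-+ _ _ (allFin m))
  where
  split-after : (y : Fin m) →
    (if ascent s x y then chainsFrom ((t ∷ I) [ i ]≔ false) y else 0) ≡
    (if ascent s x y then chainsFrom (t ∷ I) y else 0) + (if ascent s x y then chainsFrom (removeAt (t ∷ I) i) y else 0)
  split-after y = trans (cong (λ c → if ascent s x y then c else 0) (chainsFrom-split (t ∷ I) i Iᵢ y)) (if-+ (ascent s x y) _ _)

Fone-split : (m : ℕ) {n : ℕ} (I : Subset (suc n)) (i : Fin (suc n)) → lookup I i ≡ true →
             Fone m (I [ i ]≔ false) ≡ Fone m I + Fone m (removeAt I i)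
Fone-split m I i Iᵢ = begin
  Fone m (I [ i ]≔ false)
    ≡⟨ Fone≡sum-chainsFrom m (I [ i ]≔ false) ⟩
  sum (map (chainsFrom (I [ i ]≔ false)) (allFin m))
    ≡⟨ cong sum (map-cong (chainsFrom-split I i Iᵢ) (allFin m)) ⟩
  sum (map (λ x → chainsFrom I x + chainsFrom (removeAt I i) x) (allFin m))
    ≡⟨ sum-map-+ (chainsFrom I) (chainsFrom (removeAt I i)) (allFin m) ⟩
  sum (map (chainsFrom I) (allFin m)) + sum (map (chainsFrom (removeAt I i)) (allFin m))
    ≡⟨ sym (cong₂ _+_ (Fone≡sum-chainsFrom m I) (Fone≡sum-chainsFrom m (removeAt I i))) ⟩
  Fone m I + Fone m (removeAt I i) ∎
  where open ≡-Reasoning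

⌊⌋-∨-not⇔→ : {P Q : Set} (P? : Dec P) (Q? : Dec Q) → T (⌊ P? ⌋ ∨ not ⌊ Q? ⌋) ⇔ (Q → P)
⌊⌋-∨-not⇔→ (yes p) Q?      = mk⇔ (λ _ _ → p) (λ _ → tt)
⌊⌋-∨-not⇔→ (no ¬p) (yes q) = mk⇔ (λ ()) (λ q→p → ¬p (q→p q))
⌊⌋-∨-not⇔→ (no ¬p) (no ¬q) = mk⇔ (λ _ q → contradiction q ¬q) (λ _ → tt)

InjectiveVec : {A : Set} {n : ℕ} → Vec A n → Set
InjectiveVec σ = Injective _≡_ _≡_ (lookup σ)

isListing⇔injective : {n : ℕ} (σ : Vec (Fin n) n) → T (isListing σ) ⇔ InjectiveVec σ
isListing⇔injective {n} σ = mk⇔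
  (λ t {i} {j} → Equivalence.to (distinct i j) (allᵇ⁻ _ (allᵇ⁻ _ t (∈-allFin i)) (∈-allFin j)))
  (λ inj → allᵇ⁺ _ (allFin n) λ {i} _ → allᵇ⁺ _ (allFin n) λ {j} _ → Equivalence.from (distinct i j) inj)
  where
  distinct : (i j : Fin n) → T (⌊ i ≟ j ⌋ ∨ not ⌊ lookup σ i ≟ lookup σ j ⌋) ⇔ (lookup σ i ≡ lookup σ j → i ≡ j)
  distinct i j = ⌊⌋-∨-not⇔→ (i ≟ j) (lookup σ i ≟ lookup σ j)

∈-listings⁺ : {n : ℕ} {σ : Vec (Fin n) n} → InjectiveVec σ → σ ∈ listings n
∈-listings⁺ {n} {σ} inj =
  ∈-filter⁺ (T? ∘ isListing) (∈-allVecs ∈-allFin n σ) (Equivalence.from (isListing⇔injective σ) inj)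

∈-listings⁻ : {n : ℕ} {σ : Vec (Fin n) n} → σ ∈ listings n → InjectiveVec σ
∈-listings⁻ {n} {σ} σ∈ =
  Equivalence.to (isListing⇔injective σ) (proj₂ (∈-filter⁻ (T? ∘ isListing) {xs = allVecs (allFin n) n} σ∈))

listings-unique : (n : ℕ) → Unique (listings n)
listings-unique n = Unique.filter⁺ (T? ∘ isListing) (allVecs-unique (Unique.allFin⁺ n) n)

injective⇒surjective : {n : ℕ} {f : Fin n → Fin n} → Injective _≡_ _≡_ f → (y : Fin n) → ∃ λ x → f x ≡ y
injective⇒surjective {suc n} {f} f-inj y with any? (λ x → f x ≟ y)
... | yes hit  = hit
... | no  miss = contradiction (injective⇒≤ squeeze-injective) (<-irrefl refl)
  where
  y≢f : ∀ x → y ≢ f x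
  y≢f x y≡fx = miss (x , sym y≡fx)
  squeeze-injective : Injective _≡_ _≡_ (λ x → punchOut (y≢f x))
  squeeze-injective eq = f-inj (punchOut-injective (y≢f _) (y≢f _) eq)

lookup-removeAt : {A : Set} {n : ℕ} (xs : Vec A (suc n)) (i : Fin (suc n)) (p : Fin n) →
                  lookup (removeAt xs i) p ≡ lookup xs (punchIn i p)
lookup-removeAt xs i p =
  trans (cong (lookup (removeAt xs i)) (sym (punchOut-punchIn i))) (removeAt-punchOut xs (punchInᵢ≢i i p ∘ sym))

punchIn-suc-self : {n : ℕ} (i : Fin (suc n)) → punchIn (Fin.suc i) i ≡ inject₁ i
punchIn-suc-self           Fin.zero    = refl
punchIn-suc-self {suc n} (Fin.suc i) = cong Fin.suc (punchIn-suc-self i)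

≡⊎punchIn : {n : ℕ} (i p : Fin (suc n)) → p ≡ i ⊎ ∃ λ q → punchIn i q ≡ p
≡⊎punchIn i p with i ≟ p
... | yes i≡p = inj₁ (sym i≡p)
... | no  i≢p = inj₂ (punchOut i≢p , punchIn-punchOut i≢p)

-- Descent sets under deletion and contraction

descents : {A : Set} {l : ℕ} → (A → A → Bool) → Vec A (suc l) → Subset l
descents E (x ∷ [])    = []
descents E (x ∷ y ∷ w) = E x y ∷ descents E (y ∷ w)

tabulate≡descents : {A : Set} {l : ℕ} (E : A → A → Bool) (σ : Vec A (suc l)) →
                    tabulate (λ i → E (lookup σ (inject₁ i)) (lookup σ (Fin.suc i))) ≡ descents E σ
tabulate≡descents E (x ∷ [])    = refl
tabulate≡descents E (x ∷ y ∷ w) = cong (E x y ∷_) (tabulate≡descents E (y ∷ w))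

module Adjacency {n : ℕ} (a b : Fin (suc n)) where

  AdjacentAt : {l : ℕ} → Vec (Fin (suc n)) (suc l) → Fin l → Set
  AdjacentAt σ i = lookup σ (inject₁ i) ≡ a × lookup σ (Fin.suc i) ≡ b

  position : {l : ℕ} → Vec (Fin (suc n)) (suc l) → Maybe (Fin l)
  position σ with any? (λ i → (lookup σ (inject₁ i) ≟ a) ×-dec (lookup σ (Fin.suc i) ≟ b))
  ... | yes (i , _) = just i
  ... | no  _       = nothing

  position-just : {l : ℕ} (σ : Vec (Fin (suc n)) (suc l)) {i : Fin l} → position σ ≡ just i → AdjacentAt σ i
  position-just σ eq with any? (λ i → (lookup σ (inject₁ i) ≟ a) ×-dec (lookup σ (Fin.suc i) ≟ b))
  position-just σ refl | yes (_ , adjacent) = adjacent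

  position-nothing : {l : ℕ} (σ : Vec (Fin (suc n)) (suc l)) → position σ ≡ nothing → ∀ i → ¬ AdjacentAt σ i
  position-nothing σ eq i adjacent with any? (λ i → (lookup σ (inject₁ i) ≟ a) ×-dec (lookup σ (Fin.suc i) ≟ b))
  position-nothing σ ()   i adjacent | yes _
  position-nothing σ refl i adjacent | no nowhere = nowhere (i , adjacent)

  adjacentAt-unique : {l : ℕ} {σ : Vec (Fin (suc n)) (suc l)} → InjectiveVec σ →
                      ∀ {i j} → AdjacentAt σ i → AdjacentAt σ j → i ≡ j
  adjacentAt-unique inj (σᵢ≡a , _) (σⱼ≡a , _) = inject₁-injective (inj (trans σᵢ≡a (sym σⱼ≡a)))

  position-adjacentAt : {l : ℕ} (σ : Vec (Fin (suc n)) (suc l)) → InjectiveVec σ →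
                        ∀ {i} → AdjacentAt σ i → position σ ≡ just i
  position-adjacentAt σ inj {i} adjacent with position σ in eq
  ... | just j  = cong just (adjacentAt-unique {σ = σ} inj (position-just σ eq) adjacent)
  ... | nothing = contradiction adjacent (position-nothing σ eq i)

  module _ (X : Digraph (suc n)) where

    delete-edge : ∀ {x y} → ¬ (x ≡ a × y ≡ b) → edge (delete X a b) x y ≡ edge X x y
    delete-edge {x} {y} ¬ab with x ≟ a | y ≟ b
    ... | yes x≡a | yes y≡b = contradiction (x≡a , y≡b) ¬ab
    ... | yes _   | no _    = ∧-identityʳ _
    ... | no _    | _       = ∧-identityʳ _

    delete-edge-removed : edge (delete X a b) a b ≡ false
    delete-edge-removed with a ≟ a | b ≟ b
    ... | yes _  | yes _  = ∧-zeroʳ _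
    ... | no a≢a | _      = contradiction refl a≢a
    ... | yes _  | no b≢b = contradiction refl b≢b

    XDes-delete-nonadjacent : (σ : Vec (Fin (suc n)) (suc n)) → (∀ i → ¬ AdjacentAt σ i) →
                              XDes (delete X a b) σ ≡ XDes X σ
    XDes-delete-nonadjacent σ nowhere = tabulate-cong (λ i → delete-edge (nowhere i))

    XDes-delete-adjacent : (σ : Vec (Fin (suc n)) (suc n)) → InjectiveVec σ → ∀ {i} → AdjacentAt σ i →
                           XDes (delete X a b) σ ≡ XDes X σ [ i ]≔ false
    XDes-delete-adjacent σ inj {i} adjacentᵢ =
      trans (tabulate-cong entry) (tabulate∘lookup (XDes X σ [ i ]≔ false))
      where
      entry : ∀ j → edge (delete X a b) (lookup σ (inject₁ j)) (lookup σ (Fin.suc j)) ≡ lookup (XDes X σ [ i ]≔ false) j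
      entry j with j ≟ i
      ... | yes refl rewrite proj₁ adjacentᵢ | proj₂ adjacentᵢ =
        trans delete-edge-removed (sym (lookup∘update i (XDes X σ) false))
      ... | no j≢i = begin
        edge (delete X a b) (lookup σ (inject₁ j)) (lookup σ (Fin.suc j))
          ≡⟨ delete-edge (λ adjacentⱼ → j≢i (adjacentAt-unique {σ = σ} inj adjacentⱼ adjacentᵢ)) ⟩
        edge X (lookup σ (inject₁ j)) (lookup σ (Fin.suc j))
          ≡⟨ sym (lookup∘tabulate _ j) ⟩
        lookup (XDes X σ) j
          ≡⟨ sym (lookup∘update′ j≢i (XDes X σ) false) ⟩
        lookup (XDes X σ [ i ]≔ false) j ∎
        where open ≡-Reasoning

module Contraction {k : ℕ} (X : Digraph (suc (suc k))) (a b : Fin (suc (suc k))) (ab : edge X a b ≡ true) where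

  open Adjacency a b

  C : Digraph (suc k)
  C = contract X a b ab

  a≢b : a ≢ b
  a≢b = edge⇒≢ X ab

  other : Fin k → Fin (suc (suc k))
  other = rest X a b ab

  other≢a : ∀ j → other j ≢ a
  other≢a j = punchInᵢ≢i a _

  other≢b : ∀ j → other j ≢ b
  other≢b j eq = punchInᵢ≢i (punchOut a≢b) j (punchIn-injective a _ _ (trans eq (sym (punchIn-punchOut a≢b))))

  other-injective : ∀ {i j} → other i ≡ other j → i ≡ j
  other-injective eq = punchIn-injective (punchOut a≢b) _ _ (punchIn-injective a _ _ eq)

  embed : Fin (suc k) → Fin (suc (suc k))
  embed Fin.zero    = a
  embed (Fin.suc j) = other j

  merge : Fin (suc (suc k)) → Fin (suc k)
  merge u with a ≟ u
  ... | yes _ = Fin.zero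
  ... | no a≢u with punchOut a≢b ≟ punchOut a≢u
  ...   | yes _    = Fin.zero
  ...   | no b′≢u′ = Fin.suc (punchOut b′≢u′)

  merge-a : merge a ≡ Fin.zero
  merge-a with a ≟ a
  ... | yes _  = refl
  ... | no a≢a = contradiction refl a≢a

  merge-other : ∀ u → u ≢ a → u ≢ b → ∃ λ j → merge u ≡ Fin.suc j × other j ≡ u
  merge-other u u≢a u≢b with a ≟ u
  ... | yes a≡u = contradiction (sym a≡u) u≢a
  ... | no a≢u with punchOut a≢b ≟ punchOut a≢u
  ...   | yes b′≡u′ = contradiction (sym (punchOut-injective a≢b a≢u b′≡u′)) u≢b
  ...   | no b′≢u′ = punchOut b′≢u′ , refl ,
                     trans (cong (punchIn a) (punchIn-punchOut b′≢u′)) (punchIn-punchOut a≢u)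

  merge∘embed : ∀ t → merge (embed t) ≡ t
  merge∘embed Fin.zero    = merge-a
  merge∘embed (Fin.suc j) with merge-other (other j) (other≢a j) (other≢b j)
  ... | i , merged , other-i≡ = trans merged (cong Fin.suc (other-injective other-i≡))

  embed∘merge : ∀ {u} → u ≢ b → embed (merge u) ≡ u
  embed∘merge {u} u≢b with u ≟ a
  ... | yes refl = cong embed merge-a
  ... | no u≢a with merge-other u u≢a u≢b
  ...   | j , merged , other-j≡u = trans (cong embed merged) other-j≡u

  embed≢b : ∀ t → embed t ≢ b
  embed≢b Fin.zero    = a≢b
  embed≢b (Fin.suc j) = other≢b j

  embed-injective : ∀ {s t} → embed s ≡ embed t → s ≡ t
  embed-injective {s} {t} eq = trans (sym (merge∘embed s)) (trans (cong merge eq) (merge∘embed t))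

  contract-edge-suc : ∀ j t → edge C (Fin.suc j) t ≡ edge X (other j) (embed t)
  contract-edge-suc j Fin.zero    = refl
  contract-edge-suc j (Fin.suc _) = refl

  -- When τ has the contracted vertex at position i, expand replaces it by the consecutive pair a b.
  expand : {l : ℕ} → Vec (Fin (suc k)) (suc l) → Fin (suc l) → Vec (Fin (suc (suc k))) (suc (suc l))
  expand τ i = insertAt (Vec.map embed τ) (Fin.suc i) b

  squash : {l : ℕ} → Vec (Fin (suc (suc k))) (suc (suc l)) → Fin (suc l) → Vec (Fin (suc k)) (suc l)
  squash σ i = Vec.map merge (removeAt σ (Fin.suc i))

  lookup-expand-punchIn : {l : ℕ} (τ : Vec (Fin (suc k)) (suc l)) (i p : Fin (suc l)) →
                          lookup (expand τ i) (punchIn (Fin.suc i) p) ≡ embed (lookup τ p)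
  lookup-expand-punchIn τ i p = trans (insertAt-punchIn (Vec.map embed τ) (Fin.suc i) b p) (lookup-map p embed τ)

  lookup-expand-b : {l : ℕ} (τ : Vec (Fin (suc k)) (suc l)) (i : Fin (suc l)) → lookup (expand τ i) (Fin.suc i) ≡ b
  lookup-expand-b τ i = insertAt-lookup (Vec.map embed τ) (Fin.suc i) b

  lookup-expand-self : {l : ℕ} (τ : Vec (Fin (suc k)) (suc l)) (i : Fin (suc l)) →
                       lookup (expand τ i) (inject₁ i) ≡ embed (lookup τ i)
  lookup-expand-self τ i = trans (cong (lookup (expand τ i)) (sym (punchIn-suc-self i))) (lookup-expand-punchIn τ i i)

  expand-adjacentAt : {l : ℕ} (τ : Vec (Fin (suc k)) (suc l)) {i : Fin (suc l)} → lookup τ i ≡ Fin.zero →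
                      AdjacentAt (expand τ i) i
  expand-adjacentAt τ {i} τᵢ≡0 =
    trans (lookup-expand-self τ i) (cong embed τᵢ≡0) , lookup-expand-b τ i

  expand-injective : {l : ℕ} (τ : Vec (Fin (suc k)) (suc l)) → InjectiveVec τ → ∀ i → InjectiveVec (expand τ i)
  expand-injective τ inj i {p} {q} eq with ≡⊎punchIn (Fin.suc i) p | ≡⊎punchIn (Fin.suc i) q
  ... | inj₁ refl | inj₁ refl = refl
  ... | inj₁ refl | inj₂ (q′ , refl) =
    contradiction (trans (sym (lookup-expand-punchIn τ i q′)) (trans (sym eq) (lookup-expand-b τ i))) (embed≢b (lookup τ q′))
  ... | inj₂ (p′ , refl) | inj₁ refl =
    contradiction (trans (sym (lookup-expand-punchIn τ i p′)) (trans eq (lookup-expand-b τ i))) (embed≢b (lookup τ p′))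
  ... | inj₂ (p′ , refl) | inj₂ (q′ , refl) =
    cong (punchIn (Fin.suc i)) (inj (embed-injective
      (trans (sym (lookup-expand-punchIn τ i p′)) (trans eq (lookup-expand-punchIn τ i q′)))))

  expand-injective⁻ : {l : ℕ} (τ : Vec (Fin (suc k)) (suc l)) (i : Fin (suc l)) → InjectiveVec (expand τ i) → InjectiveVec τ
  expand-injective⁻ τ i inj {p} {q} eq = punchIn-injective (Fin.suc i) p q (inj
    (trans (lookup-expand-punchIn τ i p) (trans (cong embed eq) (sym (lookup-expand-punchIn τ i q)))))

  squash-expand : {l : ℕ} (τ : Vec (Fin (suc k)) (suc l)) (i : Fin (suc l)) → squash (expand τ i) i ≡ τ
  squash-expand τ i = begin
    Vec.map merge (removeAt (insertAt (Vec.map embed τ) (Fin.suc i) b) (Fin.suc i))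
      ≡⟨ cong (Vec.map merge) (removeAt-insertAt (Vec.map embed τ) (Fin.suc i) b) ⟩
    Vec.map merge (Vec.map embed τ)
      ≡⟨ sym (Vecₚ.map-∘ merge embed τ) ⟩
    Vec.map (merge ∘ embed) τ
      ≡⟨ Vecₚ.map-cong merge∘embed τ ⟩
    Vec.map id τ
      ≡⟨ map-id τ ⟩
    τ ∎
    where open ≡-Reasoning

  map-embed∘merge : {l : ℕ} (w : Vec (Fin (suc (suc k))) l) → (∀ p → lookup w p ≢ b) →
                    Vec.map embed (Vec.map merge w) ≡ w
  map-embed∘merge []      _   = refl
  map-embed∘merge (u ∷ w) w≢b = cong₂ _∷_ (embed∘merge (w≢b Fin.zero)) (map-embed∘merge w (w≢b ∘ Fin.suc))

  expand-squash : {l : ℕ} (σ : Vec (Fin (suc (suc k))) (suc (suc l))) → InjectiveVec σ →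
                  ∀ {i} → AdjacentAt σ i → expand (squash σ i) i ≡ σ
  expand-squash {l} σ inj {i} (_ , σᵢ₊₁≡b) = begin
    insertAt (Vec.map embed (Vec.map merge w)) (Fin.suc i) b
      ≡⟨ cong (λ v → insertAt v (Fin.suc i) b) (map-embed∘merge w w≢b) ⟩
    insertAt w (Fin.suc i) b
      ≡⟨ cong (insertAt w (Fin.suc i)) (sym σᵢ₊₁≡b) ⟩
    insertAt w (Fin.suc i) (lookup σ (Fin.suc i))
      ≡⟨ insertAt-removeAt σ (Fin.suc i) ⟩
    σ ∎
    where
    open ≡-Reasoning
    w : Vec (Fin (suc (suc k))) (suc l)
    w = removeAt σ (Fin.suc i)
    w≢b : ∀ p → lookup w p ≢ b
    w≢b p eq = punchInᵢ≢i (Fin.suc i) p (inj (trans (sym (lookup-removeAt σ (Fin.suc i) p)) (trans eq (sym σᵢ₊₁≡b))))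

  descents-map-embed : {l : ℕ} (ρ : Vec (Fin (suc k)) (suc l)) → (∀ p → lookup ρ p ≢ Fin.zero) →
                       descents (edge X) (Vec.map embed ρ) ≡ descents (edge C) ρ
  descents-map-embed (t ∷ [])              _   = refl
  descents-map-embed (Fin.zero ∷ t ∷ ρ)    ρ≢0 = contradiction refl (ρ≢0 Fin.zero)
  descents-map-embed (Fin.suc j ∷ t ∷ ρ)   ρ≢0 =
    cong₂ _∷_ (sym (contract-edge-suc j t)) (descents-map-embed (t ∷ ρ) (ρ≢0 ∘ Fin.suc))

  descents-expand : {l : ℕ} (τ : Vec (Fin (suc k)) (suc l)) → InjectiveVec τ → ∀ {i} → lookup τ i ≡ Fin.zero →
                    removeAt (descents (edge X) (expand τ i)) i ≡ descents (edge C) τ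
  -- i is split two levels deep in the last clauses so that removeAt sees two cons cells and reduces.
  descents-expand (t ∷ [])                    inj {Fin.zero} _ = refl
  descents-expand (Fin.zero ∷ Fin.zero ∷ τ)   inj {Fin.zero} _ = contradiction (inj {Fin.zero} {Fin.suc Fin.zero} refl) λ ()
  descents-expand (Fin.zero ∷ Fin.suc j ∷ τ)  inj {Fin.zero} _ =
    cong (edge X b (other j) ∷_) (descents-map-embed (Fin.suc j ∷ τ) (λ p τₚ≡0 → contradiction (inj {Fin.suc p} {Fin.zero} τₚ≡0) λ ()))
  descents-expand (Fin.zero ∷ t ∷ τ)          inj {Fin.suc i} τᵢ≡0 = contradiction (inj {Fin.zero} {Fin.suc i} (sym τᵢ≡0)) λ ()
  descents-expand (Fin.suc j ∷ t ∷ τ)         inj {Fin.suc Fin.zero} τᵢ≡0 =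
    cong₂ _∷_ (sym (contract-edge-suc j t)) (descents-expand (t ∷ τ) (suc-injective ∘ inj) {Fin.zero} τᵢ≡0)
  descents-expand (Fin.suc j ∷ t ∷ t′ ∷ τ)    inj {Fin.suc (Fin.suc i)} τᵢ≡0 =
    cong₂ _∷_ (sym (contract-edge-suc j t)) (descents-expand (t ∷ t′ ∷ τ) (suc-injective ∘ inj) {Fin.suc i} τᵢ≡0)

  module _ (σ : Vec (Fin (suc (suc k))) (suc (suc k))) (inj : InjectiveVec σ) {i : Fin (suc k)} (adjacentᵢ : AdjacentAt σ i) where

    squash-zero : lookup (squash σ i) i ≡ Fin.zero
    squash-zero = embed-injective (begin
      embed (lookup (squash σ i) i)         ≡⟨ sym (lookup-expand-self (squash σ i) i) ⟩
      lookup (expand (squash σ i) i) (inject₁ i) ≡⟨ cong (λ v → lookup v (inject₁ i)) (expand-squash σ inj adjacentᵢ) ⟩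
      lookup σ (inject₁ i)                  ≡⟨ proj₁ adjacentᵢ ⟩
      a ∎)
      where open ≡-Reasoning

    squash-injective : InjectiveVec (squash σ i)
    squash-injective = expand-injective⁻ (squash σ i) i (subst InjectiveVec (sym (expand-squash σ inj adjacentᵢ)) inj)

    removeAt-XDes≡XDes-squash : removeAt (XDes X σ) i ≡ XDes C (squash σ i)
    removeAt-XDes≡XDes-squash = begin
      removeAt (XDes X σ) i                                    ≡⟨ cong (λ v → removeAt v i) (tabulate≡descents (edge X) σ) ⟩
      removeAt (descents (edge X) σ) i                         ≡⟨ cong (λ v → removeAt (descents (edge X) v) i) (sym (expand-squash σ inj adjacentᵢ)) ⟩
      removeAt (descents (edge X) (expand (squash σ i) i)) i   ≡⟨ descents-expand (squash σ i) squash-injective squash-zero ⟩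
      descents (edge C) (squash σ i)                           ≡⟨ sym (tabulate≡descents (edge C) (squash σ i)) ⟩
      XDes C (squash σ i) ∎
      where open ≡-Reasoning

  contraction : Vec (Fin (suc (suc k))) (suc (suc k)) → Maybe (Vec (Fin (suc k)) (suc k))
  contraction σ = Maybe.map (squash σ) (position σ)

  contraction-just : (σ : Vec (Fin (suc (suc k))) (suc (suc k))) → InjectiveVec σ → ∀ {τ} → contraction σ ≡ just τ →
                     InjectiveVec τ × ∃ λ i → lookup τ i ≡ Fin.zero × expand τ i ≡ σ
  contraction-just σ inj eq with position σ in pos
  contraction-just σ inj refl | just i =
    squash-injective σ inj adjacentᵢ , i , squash-zero σ inj adjacentᵢ , expand-squash σ inj adjacentᵢ
    where
    adjacentᵢ : AdjacentAt σ i
    adjacentᵢ = position-just σ pos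

  contraction-expand : (τ : Vec (Fin (suc k)) (suc k)) → InjectiveVec τ → ∀ {i} → lookup τ i ≡ Fin.zero →
                       contraction (expand τ i) ≡ just τ
  contraction-expand τ inj {i} τᵢ≡0 =
    trans (cong (Maybe.map (squash (expand τ i)))
                (position-adjacentAt (expand τ i) (expand-injective τ inj i) (expand-adjacentAt τ τᵢ≡0)))
          (cong just (squash-expand τ i))

  Fone-XDes-delete : (m : ℕ) (σ : Vec (Fin (suc (suc k))) (suc (suc k))) → InjectiveVec σ →
    Fone m (XDes (delete X a b) σ) ≡ Fone m (XDes X σ) + maybe (Fone m ∘ XDes C) 0 (contraction σ)
  Fone-XDes-delete m σ inj with position σ in pos
  ... | nothing = trans (cong (Fone m) (XDes-delete-nonadjacent X σ (position-nothing σ pos))) (sym (+-identityʳ _))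
  ... | just i  = begin
    Fone m (XDes (delete X a b) σ)                        ≡⟨ cong (Fone m) (XDes-delete-adjacent X σ inj adjacentᵢ) ⟩
    Fone m (XDes X σ [ i ]≔ false)                        ≡⟨ Fone-split m (XDes X σ) i ab-at-i ⟩
    Fone m (XDes X σ) + Fone m (removeAt (XDes X σ) i)    ≡⟨ cong (λ I → Fone m (XDes X σ) + Fone m I) (removeAt-XDes≡XDes-squash σ inj adjacentᵢ) ⟩
    Fone m (XDes X σ) + Fone m (XDes C (squash σ i))      ∎
    where
    open ≡-Reasoning
    adjacentᵢ : AdjacentAt σ i
    adjacentᵢ = position-just σ pos
    ab-at-i : lookup (XDes X σ) i ≡ true
    ab-at-i = trans (lookup∘tabulate (λ j → edge X (lookup σ (inject₁ j)) (lookup σ (Fin.suc j))) i)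
                    (trans (cong₂ (edge X) (proj₁ adjacentᵢ) (proj₂ adjacentᵢ)) ab)

  u-delete≡u+u-contract : (m : ℕ) → u (delete X a b) m ≡ u X m + u C m
  u-delete≡u+u-contract m = begin
    sum (map (λ σ → Fone m (XDes (delete X a b) σ)) (listings _))
      ≡⟨ cong sum (map-cong-local (All.tabulate (λ {σ} σ∈ → Fone-XDes-delete m σ (∈-listings⁻ σ∈)))) ⟩
    sum (map (λ σ → Fone m (XDes X σ) + F (contraction σ)) (listings _))
      ≡⟨ sum-map-+ (λ σ → Fone m (XDes X σ)) (F ∘ contraction) (listings _) ⟩
    u X m + sum (map (F ∘ contraction) (listings _))
      ≡⟨ cong (_+_ (u X m)) (sum-reindex-mapMaybe contraction (Fone m ∘ XDes C)
            (listings-unique _) (listings-unique _) contraction-injective contraction-into contraction-onto) ⟩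
    u X m + u C m ∎
    where
    open ≡-Reasoning
    F : Maybe (Vec (Fin (suc k)) (suc k)) → ℕ
    F = maybe (Fone m ∘ XDes C) 0
    contraction-injective : InjectiveOn contraction (listings _)
    contraction-injective {σ} {σ′} σ∈ σ′∈ cσ cσ′
      with τ-inj , i , τᵢ≡0 , refl ← contraction-just σ (∈-listings⁻ σ∈) cσ
         | _ , i′ , τᵢ′≡0 , refl ← contraction-just σ′ (∈-listings⁻ σ′∈) cσ′
      = cong (expand _) (τ-inj (trans τᵢ≡0 (sym τᵢ′≡0)))
    contraction-into : ∀ {σ τ} → σ ∈ listings _ → contraction σ ≡ just τ → τ ∈ listings _
    contraction-into {σ} σ∈ cσ = ∈-listings⁺ (proj₁ (contraction-just σ (∈-listings⁻ σ∈) cσ))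
    contraction-onto : ∀ {τ} → τ ∈ listings _ → ∃ λ σ → σ ∈ listings _ × contraction σ ≡ just τ
    contraction-onto {τ} τ∈ with i , τᵢ≡0 ← injective⇒surjective (∈-listings⁻ τ∈) Fin.zero =
      expand τ i , ∈-listings⁺ (expand-injective τ (∈-listings⁻ τ∈) i) , contraction-expand τ (∈-listings⁻ τ∈) τᵢ≡0

+[m+n]-+n≡+m : (m n : ℕ) → + (m + n) - + n ≡ + m
+[m+n]-+n≡+m m n = trans ([+m]-[+n]≡m⊖n (m + n) n) (trans (⊖-≥ (m≤n+m n m)) (cong +_ (m+n∸n≡m m n)))

mainTheorem7 : (k : ℕ) (X : Digraph (suc (suc k))) (a b : Fin (suc (suc k)))
               (ab : edge X a b ≡ true) (m : ℕ) →
               + u X m ≡ + u (delete X a b) m - + u (contract X a b ab) m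
mainTheorem7 k X a b ab m = sym (begin
  + u (delete X a b) m - + u C m   ≡⟨ cong (λ n → + n - + u C m) (u-delete≡u+u-contract m) ⟩
  + (u X m + u C m) - + u C m      ≡⟨ +[m+n]-+n≡+m (u X m) (u C m) ⟩
  + u X m                          ∎)
  where
  open ≡-Reasoning
  open Contraction X a b ab
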